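{- The set of pseudometrics on $[n]$ satisfying the six-point condition is a subfan of the closed Wasserstein fan $\overline{\mathcal{GP}}_n$, i.e., a union of cells of $\overline{\mathcal{GP}}_n$.
   Context: A pseudometric on $[n]$ is a point $\rho=(\rho_{ij})_{i<j}$ of the closed metric cone $\overline{\mathcal M}_n=\{x\in\mathbb{R}^{\binom n2}: x_{\{i,j\}}\ge0,\ x_{\{i,j\}}+x_{\{j,k\}}\ge x_{\{i,k\}}\}$. It satisfies the six-point condition if for every $I\subseteq[n]$ with $|I|=6$ there are distinct $i,j\in I$ such that $\rho_{ij}+\rho_{kl}\le\max\{\rho_{ik}+\rho_{jl},\rho_{jk}+\rho_{il}\}$ for all distinct $k,l\in I\setminus\{i,j\}$. For $k\ge2$ and $k$-tuples $\mathbf a,\mathbf b$ of elements of $[n]$ with all $2k$ entries pairwise distinct, $H_{\mathbf a,\mathbf b}=\{x:\sum_{i=1}^k x_{\{a_i,b_i\}}=\sum_{i=1}^k x_{\{a_i,b_{i+1}\}}\}$, $b_{k+1}=b_1$. The closed Wasserstein fan $\overline{\mathcal{GP}}_n$ has as cells the intersections with $\overline{\mathcal M}_n$ of the relatively open faces of the arrangement of all such hyperplanes.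
   Formalization: The pseudometrics and all points of the cells have rational coordinates, lying in ℚ^(n choose 2) rather than ℝ^(n choose 2). -}

module Defs where

open import Data.Nat as ℕ using (ℕ; suc)
open import Data.Fin as Fin using (Fin; zero; suc; toℕ; lower₁)
open import Data.Fin.Properties using (_<?_)
open import Data.Fin.Subset using (Subset; _∈_; ∣_∣)
open import Data.Rational using (ℚ; 0ℚ; _+_; _-_; _≤_; _<_; _⊔_)
open import Data.Bool using (if_then_else_)
open import Data.Product using (_×_; ∃-syntax)
open import Relation.Nullary using (¬_; ⌊_⌋)
open import Relation.Binary.PropositionalEquality using (_≡_; _≢_)

-- A point of ℚ^(n choose 2), represented as a function on ordered pairs of
-- which only the entries x i j with i < j are ever read (via `coord`).
Point : ℕ → Set
Point n = Fin n → Fin n → ℚ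

coord : ∀ {n} → Point n → Fin n → Fin n → ℚ
coord x i j = if ⌊ i <? j ⌋ then x i j else x j i

InCone : ∀ {n} → Point n → Set
InCone {n} x =
  (∀ (i j : Fin n) → i ≢ j → 0ℚ ≤ coord x i j) ×
  (∀ (i j k : Fin n) → i ≢ j → j ≢ k → i ≢ k →
     coord x i k ≤ coord x i j + coord x j k)

SixPoint : ∀ {n} → Point n → Set
SixPoint {n} ρ =
  ∀ (I : Subset n) → ∣ I ∣ ≡ 6 →
    ∃[ i ] ∃[ j ] (i ∈ I × j ∈ I × i ≢ j ×
      (∀ (k l : Fin n) → k ∈ I → l ∈ I → k ≢ l →
         k ≢ i → k ≢ j → l ≢ i → l ≢ j →
         coord ρ i j + coord ρ k l
           ≤ (coord ρ i k + coord ρ j l) ⊔ (coord ρ j k + coord ρ i l)))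

sumFin : ∀ k → (Fin k → ℚ) → ℚ
sumFin ℕ.zero    f = 0ℚ
sumFin (suc k) f = f zero + sumFin k (λ i → f (suc i))

next : ∀ {m} → Fin (suc m) → Fin (suc m)
next {m} i with m ℕ.≟ toℕ i
... | Relation.Nullary.yes _ = zero
... | Relation.Nullary.no ne = suc (lower₁ i ne)

Admissible : ∀ {n k} → (Fin k → Fin n) → (Fin k → Fin n) → Set
Admissible {n} {k} a b =
  (∀ (p q : Fin k) → p ≢ q → a p ≢ a q) ×
  (∀ (p q : Fin k) → p ≢ q → b p ≢ b q) ×
  (∀ (p q : Fin k) → a p ≢ b q)

-- linear form whose zero set is H_{a,b} (here k = suc m, b_{k+1} = b_1)
form : ∀ {n m} → (Fin (suc m) → Fin n) → (Fin (suc m) → Fin n) → Point n → ℚ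
form {n} {m} a b x =
  sumFin (suc m) (λ i → coord x (a i) (b i))
    - sumFin (suc m) (λ i → coord x (a i) (b (next i)))

SameSign : ℚ → ℚ → Set
SameSign p q =
  ((p < 0ℚ → q < 0ℚ) × (q < 0ℚ → p < 0ℚ)) ×
  ((p ≡ 0ℚ → q ≡ 0ℚ) × (q ≡ 0ℚ → p ≡ 0ℚ)) ×
  ((0ℚ < p → 0ℚ < q) × (0ℚ < q → 0ℚ < p))

-- x and y lie in the same cell of the closed Wasserstein fan:
-- both in the closed metric cone and in the same relatively open face of
-- the arrangement of all hyperplanes H_{a,b}, k ≥ 2 (k = suc m, m ≥ 1).
SameCell : ∀ {n} → Point n → Point n → Set
SameCell {n} x y =
  InCone x × InCone y ×
  (∀ (m : ℕ) → 1 ℕ.≤ m → (a b : Fin (suc m) → Fin n) → Admissible a b →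
     SameSign (form a b x) (form a b y))

{-# OPTIONS --safe #-}

-- For k = 2 the forms of H_{(i,l),(j,k)} and H_{(j,l),(i,k)} are
-- (ρ_ij + ρ_kl) - (ρ_ik + ρ_jl) and (ρ_ij + ρ_kl) - (ρ_jk + ρ_il), so each
-- inequality of the six-point condition says that ρ is not strictly on the
-- positive side of one of these two hyperplanes. Points of one cell lie on the
-- same side of every hyperplane, hence the witnesses i, j chosen for ρ also
-- serve every ρ′ in the cell of ρ.

module Submission where

open import Defs
open import Data.Nat using (ℕ; s≤s; z≤n)
open import Data.Fin using (Fin; zero; suc)
open import Data.Fin.Properties using (_<?_; <-cmp) renaming (<-asym to <-asymᶠ)
open import Data.Rational using (0ℚ; _+_; _-_; -_; _≤_; _<_; _⊔_)
open import Data.Rational.Properties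
  using (+-identityʳ; +-inverseʳ; +-monoˡ-≤; +-monoˡ-<; ≮⇒≥; <-irrefl; <-≤-trans;
         ≤-trans; ⊔-sel; p≤p⊔q; p≤q⊔p)
open import Data.Vec.Functional using ([]; _∷_)
open import Data.Product using (_,_; proj₂)
open import Data.Sum using (_⊎_; inj₁; inj₂)
open import Data.Empty using (⊥-elim)
open import Relation.Nullary using (yes; no)
open import Relation.Binary using (tri<; tri≈; tri>)
open import Relation.Binary.PropositionalEquality

coord-comm : ∀ {n} (x : Point n) (i j : Fin n) → coord x i j ≡ coord x j i
coord-comm x i j with i <? j | j <? i
... | yes i<j | yes j<i = ⊥-elim (<-asymᶠ i<j j<i)
... | yes _   | no _    = refl
... | no _    | yes _   = refl
... | no i≮j  | no j≮i  with <-cmp i j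
...   | tri< i<j _ _    = ⊥-elim (i≮j i<j)
...   | tri≈ _ refl _   = refl
...   | tri> _ _ j<i    = ⊥-elim (j≮i j<i)

p≤q⇒p-q≤0 : ∀ {p q} → p ≤ q → p - q ≤ 0ℚ
p≤q⇒p-q≤0 {p} {q} p≤q = subst (p - q ≤_) (+-inverseʳ q) (+-monoˡ-≤ (- q) p≤q)

p<q⇒0<q-p : ∀ {p q} → p < q → 0ℚ < q - p
p<q⇒0<q-p {p} {q} p<q = subst (_< q - p) (+-inverseʳ p) (+-monoˡ-< (- p) p<q)

SameSign-≤ : ∀ {p q p′ q′} → SameSign (p - q) (p′ - q′) → p ≤ q → p′ ≤ q′
SameSign-≤ (_ , _ , _ , pos′⇒pos) p≤q =
  ≮⇒≥ λ q′<p′ → <-irrefl refl (<-≤-trans (pos′⇒pos (p<q⇒0<q-p q′<p′)) (p≤q⇒p-q≤0 p≤q))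

≤⊔⇒≤⊎≤ : ∀ {p q r} → p ≤ q ⊔ r → p ≤ q ⊎ p ≤ r
≤⊔⇒≤⊎≤ {p} {q} {r} p≤q⊔r with ⊔-sel q r
... | inj₁ q⊔r≡q = inj₁ (subst (p ≤_) q⊔r≡q p≤q⊔r)
... | inj₂ q⊔r≡r = inj₂ (subst (p ≤_) q⊔r≡r p≤q⊔r)

pair-injective : ∀ {n} {u v : Fin n} → u ≢ v →
  ∀ (p q : Fin 2) → p ≢ q → (u ∷ v ∷ []) p ≢ (u ∷ v ∷ []) q
pair-injective u≢v zero       zero       p≢q = ⊥-elim (p≢q refl)
pair-injective u≢v zero       (suc zero) _   = u≢v
pair-injective u≢v (suc zero) zero       _   = ≢-sym u≢v
pair-injective u≢v (suc zero) (suc zero) p≢q = ⊥-elim (p≢q refl)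

admissible-pairs : ∀ {n} {a₁ a₂ b₁ b₂ : Fin n} → a₁ ≢ a₂ → b₁ ≢ b₂ →
  a₁ ≢ b₁ → a₁ ≢ b₂ → a₂ ≢ b₁ → a₂ ≢ b₂ →
  Admissible (a₁ ∷ a₂ ∷ []) (b₁ ∷ b₂ ∷ [])
admissible-pairs {a₁ = a₁} {a₂} {b₁} {b₂} a₁≢a₂ b₁≢b₂ a₁≢b₁ a₁≢b₂ a₂≢b₁ a₂≢b₂ =
  pair-injective a₁≢a₂ , pair-injective b₁≢b₂ , apart
  where
  apart : ∀ p q → (a₁ ∷ a₂ ∷ []) p ≢ (b₁ ∷ b₂ ∷ []) q
  apart zero       zero       = a₁≢b₁
  apart zero       (suc zero) = a₁≢b₂
  apart (suc zero) zero       = a₂≢b₁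
  apart (suc zero) (suc zero) = a₂≢b₂

four-point-form : ∀ {n} (x : Point n) (i j k l : Fin n) →
  form (i ∷ l ∷ []) (j ∷ k ∷ []) x
    ≡ (coord x i j + coord x k l) - (coord x i k + coord x j l)
four-point-form x i j k l = begin
  form (i ∷ l ∷ []) (j ∷ k ∷ []) x
    ≡⟨⟩
  (coord x i j + (coord x l k + 0ℚ)) - (coord x i k + (coord x l j + 0ℚ))
    ≡⟨ cong₂ (λ u v → (coord x i j + u) - (coord x i k + v))
         (trans (+-identityʳ _) (coord-comm x l k))
         (trans (+-identityʳ _) (coord-comm x l j)) ⟩
  (coord x i j + coord x k l) - (coord x i k + coord x j l)
    ∎
  where open ≡-Reasoning

SameCell-four-point-≤ : ∀ {n} {ρ ρ′ : Point n} → SameCell ρ ρ′ → {i j k l : Fin n} →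
  i ≢ j → k ≢ l → k ≢ i → k ≢ j → l ≢ i → l ≢ j →
  coord ρ  i j + coord ρ  k l ≤ coord ρ  i k + coord ρ  j l →
  coord ρ′ i j + coord ρ′ k l ≤ coord ρ′ i k + coord ρ′ j l
SameCell-four-point-≤ {ρ = ρ} {ρ′} cell {i} {j} {k} {l} i≢j k≢l k≢i k≢j l≢i l≢j = SameSign-≤
  (subst₂ SameSign (four-point-form ρ i j k l) (four-point-form ρ′ i j k l)
    (proj₂ (proj₂ cell) 1 (s≤s z≤n) _ _
      (admissible-pairs (≢-sym l≢i) (≢-sym k≢j) i≢j (≢-sym k≢i) l≢j (≢-sym k≢l))))

SameCell-four-point-≤⊔ : ∀ {n} {ρ ρ′ : Point n} → SameCell ρ ρ′ → {i j k l : Fin n} →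
  i ≢ j → k ≢ l → k ≢ i → k ≢ j → l ≢ i → l ≢ j →
  coord ρ  i j + coord ρ  k l ≤ (coord ρ  i k + coord ρ  j l) ⊔ (coord ρ  j k + coord ρ  i l) →
  coord ρ′ i j + coord ρ′ k l ≤ (coord ρ′ i k + coord ρ′ j l) ⊔ (coord ρ′ j k + coord ρ′ i l)
SameCell-four-point-≤⊔ {ρ = ρ} {ρ′} cell {i} {j} {k} {l} i≢j k≢l k≢i k≢j l≢i l≢j ≤⊔
  with ≤⊔⇒≤⊎≤ ≤⊔
... | inj₁ ≤ik+jl = ≤-trans
  (SameCell-four-point-≤ cell i≢j k≢l k≢i k≢j l≢i l≢j ≤ik+jl)
  (p≤p⊔q _ _)
... | inj₂ ≤jk+il = ≤-trans
  (subst (_≤ coord ρ′ j k + coord ρ′ i l) (swap ρ′)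
    (SameCell-four-point-≤ cell (≢-sym i≢j) k≢l k≢j k≢i l≢j l≢i
      (subst (_≤ coord ρ j k + coord ρ i l) (sym (swap ρ)) ≤jk+il)))
  (p≤q⊔p (coord ρ′ i k + coord ρ′ j l) _)
  where
  swap : ∀ x → coord x j i + coord x k l ≡ coord x i j + coord x k l
  swap x = cong (_+ coord x k l) (coord-comm x j i)

proposition6p15 : ∀ (n : ℕ) (ρ ρ′ : Point n) →
    SameCell ρ ρ′ → SixPoint ρ → SixPoint ρ′
proposition6p15 n ρ ρ′ cell six I ∣I∣≡6 with six I ∣I∣≡6
... | i , j , i∈I , j∈I , i≢j , four-point =
  i , j , i∈I , j∈I , i≢j ,
  λ k l k∈I l∈I k≢l k≢i k≢j l≢i l≢j →
    SameCell-four-point-≤⊔ cell i≢j k≢l k≢i k≢j l≢i l≢j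
      (four-point k l k∈I l∈I k≢l k≢i k≢j l≢i l≢j)
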